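{- The following hold. (1) For every integer $l\ge 0$ and $k=4l+2$, one has $\chi(\mathbb{Z}^{4},\sqrt{k})\le 4$ and $\chi(\mathbb{Z}^{5},\sqrt{k})\le 8$. (2) For every positive integer $k$, $\chi(\mathbb{Z}^{4},\sqrt{8k})=\chi(\mathbb{Z}^{4},\sqrt{2k})$. (3) For every odd positive integer $l$, $\chi(\mathbb{Z}^{4},\sqrt{4l})\le 4$.
   Context: For a metric space $M$ and a real number $d>0$, the chromatic number $\chi(M,d)$ is the minimal cardinality of a set $S$ for which there is a map $f:M\to S$ with $f(x)\neq f(y)$ whenever the distance between $x$ and $y$ equals $d$. Here $\mathbb{Z}^{4}$ and $\mathbb{Z}^{5}$ carry the Euclidean metric. -}

module Defs where

open import Data.Nat using (ℕ; zero; suc)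
open import Data.Integer using (ℤ; +_; _+_; _-_; _*_)
open import Data.Fin using (Fin)
import Data.Fin as F
open import Data.Product using (Σ; ∃)
open import Relation.Binary.PropositionalEquality using (_≡_; _≢_)

Point : ℕ → Set
Point n = Fin n → ℤ

sumFin : (n : ℕ) → (Fin n → ℤ) → ℤ
sumFin zero    f = + 0
sumFin (suc n) f = f F.zero + sumFin n (λ i → f (F.suc i))

sqDist : (n : ℕ) → Point n → Point n → ℤ
sqDist n x y = sumFin n (λ i → (x i - y i) * (x i - y i))

ProperColouring : (n k c : ℕ) → (Point n → Fin c) → Set
ProperColouring n k c f = ∀ x y → sqDist n x y ≡ + k → f x ≢ f y

Colourable : (n k c : ℕ) → Set
Colourable n k c = Σ (Point n → Fin c) (ProperColouring n k c)

module Submission where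

-- Everything rests on residues of squares: for integers a, b the square
-- (a - b)² is ≡ 0 (mod 4) if a and b have equal parity and ≡ 1 (mod 8)
-- otherwise.  Summing over coordinates, the squared distance of two points of
-- ℤⁿ is congruent mod 4 to the number of coordinates whose parities differ
-- (their "odd count"), and congruent to n mod 8 if all parities differ; in ℤ⁴
-- a squared distance ≡ 0 (mod 8) therefore has all differences even.
--   (1) The colourings x ↦ (x₀+x₁, x₁+x₂) mod 2 of ℤ⁴ and
--       x ↦ (x₀+x₁, x₃+x₄, x₀+x₂+x₄) mod 2 of ℤ⁵ are linear over 𝔽₂, so two
--       points of equal colour have an odd count in {0,1,3,4}, never ≡ 2 (mod 4).
--   (2) Doubling the coordinates multiplies squared distances by 4 and turns a
--       colouring for 8k into one for 2k; conversely points at squared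
--       distance 8k differ by an even vector, so halving (rounding down)
--       turns a colouring for 2k into one for 8k.
--   (3) For 4l with l odd, colour x by the parities of x₀ and of Σ⌊xᵢ/2⌋.
--       Equal colours force all differences even; the halved points are then at
--       squared distance l, which is ≡ Σ⌊xᵢ/2⌋ - Σ⌊yᵢ/2⌋ ≡ 0 (mod 2) because
--       e² ≡ e (mod 2), contradicting l odd.

open import Defs
open import Data.Nat using (ℕ; zero; suc)
open import Data.Product using (_×_; _,_)
open import Function.Bundles using (_⇔_; mk⇔)

module Colourings where
  open import Algebra.Bundles using (CommutativeRing)
  import Algebra.Properties.CommutativeSemigroup as CommutativeSemigroupProperties
  open import Data.Bool using (Bool; true; false; _xor_; T)
  open import Data.Bool.Properties using (xor-same; xor-∧-commutativeRing)
  open import Data.Empty using (⊥; ⊥-elim)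
  open import Data.Fin using (Fin; zero; suc; combine)
  open import Data.Fin.Patterns using (0F; 1F; 2F; 3F; 4F)
  open import Data.Fin.Properties using (combine-injective)
  open import Data.Integer using (ℤ; +_; _+_; _-_; _*_; -_; ∣_∣)
  open import Data.Integer.DivMod using (_/ℕ_; _%ℕ_; a≡a%ℕn+[a/ℕn]*n; n%ℕd<d)
  open import Data.Integer.Divisibility.Signed
    using (_∣_; divides; ∣-trans; ∣m⇒∣-m; ∣m∣n⇒∣m+n; ∣⇒∣ᵤ)
  open import Data.Integer.Properties
    using (pos-+; pos-*; *-cancelˡ-≡; +-identityʳ; +-inverseʳ; *-comm)
  open import Data.Integer.Tactic.RingSolver using (solve; solve-∀)
  open import Data.List using (_∷_; [])
  import Data.Nat as ℕ
  open import Data.Nat.Divisibility using (∣⇒≤)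
  import Data.Nat.Properties as ℕ
  open import Data.Product using (∃; _,_; proj₁; proj₂)
  import Data.Product as Product
  open import Data.Sum using (_⊎_; inj₁; inj₂)
  import Data.Sum as Sum
  open import Data.Vec.Functional using (map; tail)
  open import Function using (_∘_)
  open import Relation.Nullary using (¬_)
  open import Relation.Binary.PropositionalEquality
  open ≡-Reasoning

  open CommutativeSemigroupProperties
    (CommutativeRing.+-commutativeSemigroup xor-∧-commutativeRing) using (interchange)

  -- Congruence of integers modulo a natural number: m divides a - b.  It is a
  -- record so that a, b and m can be inferred from a congruence proof.

  infix 4 _≡_mod_

  record _≡_mod_ (a b : ℤ) (m : ℕ) : Set where
    constructor modulus-divides
    field difference-divisible : + m ∣ a - b

  mod-witness : ∀ {m a b} q → a - b ≡ q * + m → a ≡ b mod m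
  mod-witness q eq = modulus-divides (divides q eq)

  difference-of-sums : ∀ a b c d → (a - b) + (c - d) ≡ (a + c) - (b + d)
  difference-of-sums = solve-∀

  mod-reflexive : ∀ {m a b} → a ≡ b → a ≡ b mod m
  mod-reflexive {a = a} refl = mod-witness (+ 0) (+-inverseʳ a)

  mod-sym : ∀ {m a b} → a ≡ b mod m → b ≡ a mod m
  mod-sym {m} {a} {b} (modulus-divides a≡b) = modulus-divides (subst (+ m ∣_) (negate a b) (∣m⇒∣-m a≡b))
    where
    negate : ∀ a b → - (a - b) ≡ b - a
    negate = solve-∀

  mod-trans : ∀ {m a b c} → a ≡ b mod m → b ≡ c mod m → a ≡ c mod m
  mod-trans {m} {a} {b} {c} (modulus-divides a≡b) (modulus-divides b≡c) = modulus-divides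
    (subst (+ m ∣_) (trans (difference-of-sums a b b c) (telescope a b c)) (∣m∣n⇒∣m+n a≡b b≡c))
    where
    telescope : ∀ a b c → (a + b) - (b + c) ≡ a - c
    telescope = solve-∀

  mod-+ : ∀ {m a b c d} → a ≡ b mod m → c ≡ d mod m → a + c ≡ b + d mod m
  mod-+ {m} {a} {b} {c} {d} (modulus-divides a≡b) (modulus-divides c≡d) = modulus-divides
    (subst (+ m ∣_) (difference-of-sums a b c d) (∣m∣n⇒∣m+n a≡b c≡d))

  mod-weaken : ∀ {m k a b} → + m ∣ + k → a ≡ b mod k → a ≡ b mod m
  mod-weaken m∣k (modulus-divides k∣a-b) = modulus-divides (∣-trans m∣k k∣a-b)

  mod-difference : ∀ {m a b} → a ≡ b mod m → a - b ≡ + 0 mod m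
  mod-difference (modulus-divides (divides q eq)) = mod-witness q (trans (+-identityʳ _) eq)

  incongruent : ∀ {m a b} → a ≡ b mod m → .{{_ : ℕ.NonZero ∣ a - b ∣}} →
                T (∣ a - b ∣ ℕ.<ᵇ m) → ⊥
  incongruent {m} (modulus-divides a≡b) small = ℕ.<⇒≱ (ℕ.<ᵇ⇒< _ m small) (∣⇒≤ (∣⇒∣ᵤ a≡b))

  multiple-mod : ∀ m q → + (m ℕ.* q) ≡ + 0 mod m
  multiple-mod m q = mod-witness (+ q) (trans (+-identityʳ _) (trans (pos-* m q) (*-comm (+ m) (+ q))))

  offset-mod : ∀ m q b → + (m ℕ.* q ℕ.+ b) ≡ + b mod m
  offset-mod m q b = subst (λ t → t ≡ + b mod m) (sym (pos-+ (m ℕ.* q) b))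
                       (mod-+ (multiple-mod m q) (mod-reflexive {a = + b} refl))

  bit : Bool → ℕ
  bit false = 0
  bit true  = 1

  -- parity a is true iff a is odd, and half a = ⌊a/2⌋.
  parity : ℤ → Bool
  parity a = a %ℕ 2 ℕ.≡ᵇ 1

  half : ℤ → ℤ
  half a = a /ℕ 2

  divide-by-2 : ∀ a → a ≡ + 2 * half a + + bit (parity a)
  divide-by-2 a = trans (a≡a%ℕn+[a/ℕn]*n a 2) (reorder (a %ℕ 2) (n%ℕd<d a 2) (half a))
    where
    reorder : ∀ r → r ℕ.< 2 → ∀ h → + r + h * + 2 ≡ + 2 * h + + bit (r ℕ.≡ᵇ 1)
    reorder 0 _ = solve-∀
    reorder 1 _ = solve-∀
    reorder (suc (suc _)) (ℕ.s≤s (ℕ.s≤s ()))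

  differ : ℤ → ℤ → Bool
  differ a b = parity a xor parity b

  xor-false : ∀ {a b} → a xor b ≡ false → a ≡ b
  xor-false {false} {false} _ = refl
  xor-false {true}  {true}  _ = refl
  xor-false {false} {true}  ()
  xor-false {true}  {false} ()

  differ-same : ∀ {a b} → parity a ≡ parity b → differ a b ≡ false
  differ-same {a} same = trans (cong (parity a xor_) (sym same)) (xor-same (parity a))

  even-difference : ∀ a b → parity a ≡ parity b → a - b ≡ + 2 * (half a - half b)
  even-difference a b same =
    trans (cong₂ _-_ (divide-by-2 a) (trans (divide-by-2 b) (cong (λ p → + 2 * half b + + bit p) (sym same))))
          (cancel-remainder (half a) (half b) (+ bit (parity a)))
    where
    cancel-remainder : ∀ h k r → (+ 2 * h + r) - (+ 2 * k + r) ≡ + 2 * (h - k)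
    cancel-remainder = solve-∀

  same-parity-mod2 : ∀ a b → parity a ≡ parity b → a ≡ b mod 2
  same-parity-mod2 a b same = mod-witness (half a - half b) (trans (even-difference a b same) (*-comm (+ 2) _))

  odd-difference : ∀ a b → differ a b ≡ true → ∃ λ q → a - b ≡ + 2 * q + + 1
  odd-difference a b odd with parity a | parity b | divide-by-2 a | divide-by-2 b
  ... | true  | false | ha | hb = half a - half b , trans (cong₂ _-_ ha hb) (odd-minus-even (half a) (half b))
    where
    odd-minus-even : ∀ h k → (+ 2 * h + + 1) - (+ 2 * k + + 0) ≡ + 2 * (h - k) + + 1
    odd-minus-even = solve-∀
  ... | false | true  | ha | hb = half a - half b - + 1 , trans (cong₂ _-_ ha hb) (even-minus-odd (half a) (half b))
    where
    even-minus-odd : ∀ h k → (+ 2 * h + + 0) - (+ 2 * k + + 1) ≡ + 2 * (h - k - + 1) + + 1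
    even-minus-odd = solve-∀
  odd-difference a b () | true  | true  | _ | _
  odd-difference a b () | false | false | _ | _

  square-mod2 : ∀ q → q * q ≡ q mod 2
  square-mod2 q = subst (λ a → a * a ≡ a mod 2) (sym (divide-by-2 q)) (by-remainder (half q) (parity q))
    where
    by-remainder : ∀ h r → (+ 2 * h + + bit r) * (+ 2 * h + + bit r) ≡ + 2 * h + + bit r mod 2
    by-remainder h false = mod-witness (+ 2 * h * h - h) (solve (h ∷ []))
    by-remainder h true  = mod-witness (+ 2 * h * h + h) (solve (h ∷ []))

  even-square : ∀ e → (+ 2 * e) * (+ 2 * e) ≡ + 0 mod 4
  even-square e = mod-witness (e * e) (solve (e ∷ []))

  -- (2q+1)² ≡ 1 (mod 8), since (2q+1)² - 1 = 4(q² - q) + 8q and q² - q is even.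
  odd-square : ∀ q → (+ 2 * q + + 1) * (+ 2 * q + + 1) ≡ + 1 mod 8
  odd-square q with square-mod2 q
  ... | modulus-divides (divides w q²-q≡2w) = mod-witness (w + q) (begin
    (+ 2 * q + + 1) * (+ 2 * q + + 1) - + 1  ≡⟨ expand q ⟩
    + 4 * (q * q - q) + + 8 * q              ≡⟨ cong (λ t → + 4 * t + + 8 * q) q²-q≡2w ⟩
    + 4 * (w * + 2) + + 8 * q                ≡⟨ collect w q ⟩
    (w + q) * + 8                            ∎)
    where
    expand : ∀ q → (+ 2 * q + + 1) * (+ 2 * q + + 1) - + 1 ≡ + 4 * (q * q - q) + + 8 * q
    expand = solve-∀
    collect : ∀ w q → + 4 * (w * + 2) + + 8 * q ≡ (w + q) * + 8
    collect = solve-∀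

  odd-difference-square : ∀ a b → differ a b ≡ true → (a - b) * (a - b) ≡ + 1 mod 8
  odd-difference-square a b odd with odd-difference a b odd
  ... | q , d = subst (λ t → t * t ≡ + 1 mod 8) (sym d) (odd-square q)

  square-mod4 : ∀ a b → (a - b) * (a - b) ≡ + bit (differ a b) mod 4
  square-mod4 a b with differ a b in d
  ... | false = subst (λ t → t * t ≡ + 0 mod 4) (sym (even-difference a b (xor-false d)))
                      (even-square (half a - half b))
  ... | true  = mod-weaken (divides (+ 2) refl) (odd-difference-square a b d)

  halve : ∀ {n} → Point n → Point n
  halve = map half

  double : ∀ {n} → Point n → Point n
  double = map (+ 2 *_)

  oddCount : (n : ℕ) → Point n → Point n → ℕ
  oddCount zero    x y = 0
  oddCount (suc n) x y = bit (differ (x zero) (y zero)) ℕ.+ oddCount n (tail x) (tail y)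

  sqDist-mod4 : ∀ n x y → sqDist n x y ≡ + oddCount n x y mod 4
  sqDist-mod4 zero    x y = mod-reflexive refl
  sqDist-mod4 (suc n) x y =
    subst (λ t → sqDist (suc n) x y ≡ t mod 4) (sym (pos-+ (bit (differ (x zero) (y zero))) _))
          (mod-+ (square-mod4 (x zero) (y zero)) (sqDist-mod4 n (tail x) (tail y)))

  sqDist-all-odd : ∀ n x y → (∀ i → differ (x i) (y i) ≡ true) → sqDist n x y ≡ + n mod 8
  sqDist-all-odd zero    x y _   = mod-reflexive refl
  sqDist-all-odd (suc n) x y odd =
    mod-+ (odd-difference-square (x zero) (y zero) (odd zero))
          (sqDist-all-odd n (tail x) (tail y) (odd ∘ suc))

  sqDist-scale : ∀ n x y a b → (∀ i → x i - y i ≡ + 2 * (a i - b i)) →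
                 sqDist n x y ≡ + 4 * sqDist n a b
  sqDist-scale zero    x y a b _ = refl
  sqDist-scale (suc n) x y a b d =
    trans (cong₂ (λ s t → s * s + t) (d zero) (sqDist-scale n (tail x) (tail y) (tail a) (tail b) (d ∘ suc)))
          (factor (a zero - b zero) (sqDist n (tail a) (tail b)))
    where
    factor : ∀ e s → (+ 2 * e) * (+ 2 * e) + + 4 * s ≡ + 4 * (e * e + s)
    factor = solve-∀

  sqDist-halve : ∀ n x y → (∀ i → parity (x i) ≡ parity (y i)) →
                 sqDist n x y ≡ + 4 * sqDist n (halve x) (halve y)
  sqDist-halve n x y even = sqDist-scale n x y (halve x) (halve y) (λ i → even-difference (x i) (y i) (even i))

  sqDist-double : ∀ n x y → sqDist n (double x) (double y) ≡ + 4 * sqDist n x y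
  sqDist-double n x y = sqDist-scale n (double x) (double y) x y (λ i → distribute (x i) (y i))
    where
    distribute : ∀ a b → + 2 * a - + 2 * b ≡ + 2 * (a - b)
    distribute = solve-∀

  sqDist-mod2 : ∀ n a b → sqDist n a b ≡ sumFin n a - sumFin n b mod 2
  sqDist-mod2 zero    a b = mod-reflexive refl
  sqDist-mod2 (suc n) a b =
    subst (λ t → sqDist (suc n) a b ≡ t mod 2) (difference-of-sums (a zero) (b zero) _ _)
          (mod-+ (square-mod2 (a zero - b zero)) (sqDist-mod2 n (tail a) (tail b)))

  bit≤1 : ∀ b → bit b ℕ.≤ 1
  bit≤1 false = ℕ.z≤n
  bit≤1 true  = ℕ.≤-refl

  oddCount-bound : ∀ n x y → oddCount n x y ℕ.≤ n
  oddCount-bound zero    x y = ℕ.z≤n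
  oddCount-bound (suc n) x y = ℕ.+-mono-≤ (bit≤1 (differ (x zero) (y zero))) (oddCount-bound n (tail x) (tail y))

  bit-zero : ∀ {b} → bit b ≡ 0 → b ≡ false
  bit-zero {false} _ = refl

  oddCount-zero : ∀ n x y → oddCount n x y ≡ 0 → ∀ i → parity (x i) ≡ parity (y i)
  oddCount-zero (suc n) x y none zero    = xor-false (bit-zero (ℕ.m+n≡0⇒m≡0 _ none))
  oddCount-zero (suc n) x y none (suc i) = oddCount-zero n (tail x) (tail y) (ℕ.m+n≡0⇒n≡0 _ none) i

  full-split : ∀ b {c n} → bit b ℕ.+ c ≡ suc n → c ℕ.≤ n → b ≡ true × c ≡ n
  full-split true  c≡n  _   = refl , ℕ.suc-injective c≡n
  full-split false refl c≤n = ⊥-elim (ℕ.<-irrefl refl c≤n)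

  oddCount-full : ∀ n x y → oddCount n x y ≡ n → ∀ i → differ (x i) (y i) ≡ true
  oddCount-full (suc n) x y full i
    with full-split (differ (x zero) (y zero)) full (oddCount-bound n (tail x) (tail y))
  oddCount-full (suc n) x y full zero    | head , _    = head
  oddCount-full (suc n) x y full (suc i) | _    , rest = oddCount-full n (tail x) (tail y) rest i

  small-multiple-of-4 : ∀ c → c ℕ.≤ 4 → + c ≡ + 0 mod 4 → c ≡ 0 ⊎ c ≡ 4
  small-multiple-of-4 0 _ _ = inj₁ refl
  small-multiple-of-4 1 _ c≡0 = ⊥-elim (incongruent c≡0 _)
  small-multiple-of-4 2 _ c≡0 = ⊥-elim (incongruent c≡0 _)
  small-multiple-of-4 3 _ c≡0 = ⊥-elim (incongruent c≡0 _)
  small-multiple-of-4 4 _ _ = inj₂ refl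
  small-multiple-of-4 (suc (suc (suc (suc (suc _))))) (ℕ.s≤s (ℕ.s≤s (ℕ.s≤s (ℕ.s≤s ())))) _

  four-squares-mod4 : ∀ x y → sqDist 4 x y ≡ + 0 mod 4 →
                      (∀ i → parity (x i) ≡ parity (y i)) ⊎ (∀ i → differ (x i) (y i) ≡ true)
  four-squares-mod4 x y s≡0 =
    Sum.map (oddCount-zero 4 x y) (oddCount-full 4 x y)
            (small-multiple-of-4 (oddCount 4 x y) (oddCount-bound 4 x y)
                                 (mod-trans (mod-sym (sqDist-mod4 4 x y)) s≡0))

  -- Four squares summing to 0 mod 8: all differences are even, as four odd
  -- squares sum to 4 mod 8.
  four-squares-mod8 : ∀ x y → sqDist 4 x y ≡ + 0 mod 8 → ∀ i → parity (x i) ≡ parity (y i)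
  four-squares-mod8 x y s≡0 = Sum.[ (λ even → even) , ⊥-elim ∘ not-all-odd ]′ (four-squares-mod4 x y s≡0mod4)
    where
    s≡0mod4 : sqDist 4 x y ≡ + 0 mod 4
    s≡0mod4 = mod-weaken (divides (+ 2) refl) s≡0

    not-all-odd : (∀ i → differ (x i) (y i) ≡ true) → ⊥
    not-all-odd odd = incongruent (mod-trans (mod-sym (sqDist-all-odd 4 x y odd)) s≡0) _

  bitFin : Bool → Fin 2
  bitFin false = 0F
  bitFin true  = 1F

  bitFin-injective : ∀ {a b} → bitFin a ≡ bitFin b → a ≡ b
  bitFin-injective {false} {false} _ = refl
  bitFin-injective {true}  {true}  _ = refl
  bitFin-injective {false} {true}  ()
  bitFin-injective {true}  {false} ()

  code₂ : Bool → Bool → Fin 4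
  code₂ a b = combine (bitFin a) (bitFin b)

  code₂-injective : ∀ {a b c d} → code₂ a b ≡ code₂ c d → a ≡ c × b ≡ d
  code₂-injective eq = Product.map bitFin-injective bitFin-injective (combine-injective _ _ _ _ eq)

  code₃ : Bool → Bool → Bool → Fin 8
  code₃ a b c = combine (bitFin a) (code₂ b c)

  code₃-injective : ∀ {a b c d e f} → code₃ a b c ≡ code₃ d e f → a ≡ d × b ≡ e × c ≡ f
  code₃-injective eq = Product.map bitFin-injective code₂-injective (combine-injective _ _ _ _ eq)

  pair-feature : ∀ {n} (x y : Point n) i j →
                 parity (x i) xor parity (x j) ≡ parity (y i) xor parity (y j) →
                 differ (x i) (y i) ≡ differ (x j) (y j)
  pair-feature x y i j eq = xor-false (begin
    differ (x i) (y i) xor differ (x j) (y j)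
      ≡⟨ interchange (parity (x i)) (parity (x j)) (parity (y i)) (parity (y j)) ⟨
    p xor p′  ≡⟨ cong (p xor_) (sym eq) ⟩
    p xor p   ≡⟨ xor-same p ⟩
    false     ∎)
    where
    p p′ : Bool
    p  = parity (x i) xor parity (x j)
    p′ = parity (y i) xor parity (y j)

  triple-feature : ∀ {n} (x y : Point n) i j k →
                   parity (x i) xor (parity (x j) xor parity (x k)) ≡ parity (y i) xor (parity (y j) xor parity (y k)) →
                   differ (x i) (y i) xor (differ (x j) (y j) xor differ (x k) (y k)) ≡ false
  triple-feature x y i j k eq = begin
    differ (x i) (y i) xor (differ (x j) (y j) xor differ (x k) (y k))
      ≡⟨ cong (differ (x i) (y i) xor_) (interchange (parity (x j)) (parity (x k)) (parity (y j)) (parity (y k))) ⟨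
    differ (x i) (y i) xor ((parity (x j) xor parity (x k)) xor (parity (y j) xor parity (y k)))
      ≡⟨ interchange (parity (x i)) (parity (x j) xor parity (x k)) (parity (y i)) (parity (y j) xor parity (y k)) ⟨
    p xor p′
      ≡⟨ cong (p xor_) (sym eq) ⟩
    p xor p
      ≡⟨ xor-same p ⟩
    false ∎
    where
    p p′ : Bool
    p  = parity (x i) xor (parity (x j) xor parity (x k))
    p′ = parity (y i) xor (parity (y j) xor parity (y k))

  -- Part (1): distance √(4l+2) in ℤ⁴ and ℤ⁵.

  oddCount-4l+2 : ∀ n l x y → sqDist n x y ≡ + (4 ℕ.* l ℕ.+ 2) → + oddCount n x y ≡ + 2 mod 4
  oddCount-4l+2 n l x y dist = mod-trans (mod-sym (sqDist-mod4 n x y)) (mod-trans (mod-reflexive dist) (offset-mod 4 l 2))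

  no-two-in-four : ∀ u₀ u₁ u₂ u₃ → u₀ ≡ u₁ → u₁ ≡ u₂ →
                   ¬ (+ (bit u₀ ℕ.+ (bit u₁ ℕ.+ (bit u₂ ℕ.+ (bit u₃ ℕ.+ 0)))) ≡ + 2 mod 4)
  no-two-in-four false _ _ false refl refl c≡2 = incongruent c≡2 _
  no-two-in-four false _ _ true  refl refl c≡2 = incongruent c≡2 _
  no-two-in-four true  _ _ false refl refl c≡2 = incongruent c≡2 _
  no-two-in-four true  _ _ true  refl refl c≡2 = incongruent c≡2 _

  no-two-in-five : ∀ u₀ u₁ u₂ u₃ u₄ → u₀ ≡ u₁ → u₃ ≡ u₄ → u₀ xor (u₂ xor u₄) ≡ false →
                   ¬ (+ (bit u₀ ℕ.+ (bit u₁ ℕ.+ (bit u₂ ℕ.+ (bit u₃ ℕ.+ (bit u₄ ℕ.+ 0))))) ≡ + 2 mod 4)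
  no-two-in-five false _ false false _ refl refl _ c≡2 = incongruent c≡2 _
  no-two-in-five false _ true  true  _ refl refl _ c≡2 = incongruent c≡2 _
  no-two-in-five true  _ false true  _ refl refl _ c≡2 = incongruent c≡2 _
  no-two-in-five true  _ true  false _ refl refl _ c≡2 = incongruent c≡2 _
  no-two-in-five false _ false true  _ refl refl ()
  no-two-in-five false _ true  false _ refl refl ()
  no-two-in-five true  _ false false _ refl refl ()
  no-two-in-five true  _ true  true  _ refl refl ()

  colour₄ : Point 4 → Fin 4
  colour₄ x = code₂ (parity (x 0F) xor parity (x 1F)) (parity (x 1F) xor parity (x 2F))

  colouring-4l+2-dim4 : ∀ l → Colourable 4 (4 ℕ.* l ℕ.+ 2) 4
  colouring-4l+2-dim4 l = colour₄ , proper
    where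
    proper : ProperColouring 4 (4 ℕ.* l ℕ.+ 2) 4 colour₄
    proper x y dist same with code₂-injective same
    ... | f₀₁ , f₁₂ = no-two-in-four _ _ _ (differ (x 3F) (y 3F))
                        (pair-feature x y 0F 1F f₀₁) (pair-feature x y 1F 2F f₁₂)
                        (oddCount-4l+2 4 l x y dist)

  colour₅ : Point 5 → Fin 8
  colour₅ x = code₃ (parity (x 0F) xor parity (x 1F))
                    (parity (x 3F) xor parity (x 4F))
                    (parity (x 0F) xor (parity (x 2F) xor parity (x 4F)))

  colouring-4l+2-dim5 : ∀ l → Colourable 5 (4 ℕ.* l ℕ.+ 2) 8
  colouring-4l+2-dim5 l = colour₅ , proper
    where
    proper : ProperColouring 5 (4 ℕ.* l ℕ.+ 2) 8 colour₅
    proper x y dist same with code₃-injective same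
    ... | f₀₁ , f₃₄ , f₀₂₄ = no-two-in-five _ _ (differ (x 2F) (y 2F)) _ _
                               (pair-feature x y 0F 1F f₀₁) (pair-feature x y 3F 4F f₃₄)
                               (triple-feature x y 0F 2F 4F f₀₂₄)
                               (oddCount-4l+2 5 l x y dist)

  -- Part (2): distances √(8s) and √(2s) in ℤ⁴.

  pullback : ∀ {n n′ k k′ c} (g : Point n → Point n′) →
             (∀ x y → sqDist n x y ≡ + k → sqDist n′ (g x) (g y) ≡ + k′) →
             Colourable n′ k′ c → Colourable n k c
  pullback g preserves (f , proper) = f ∘ g , λ x y dist → proper (g x) (g y) (preserves x y dist)

  -- Doubling sends squared distance 2s to 8s in any dimension; in ℤ⁴ halving
  -- sends 8s back to 2s, because all differences are then even.
  four-times-2s : ∀ s → + 4 * + (2 ℕ.* s) ≡ + (8 ℕ.* s)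
  four-times-2s s = trans (sym (pos-* 4 (2 ℕ.* s))) (cong +_ (sym (ℕ.*-assoc 4 2 s)))

  doubling-distance : ∀ n s x y → sqDist n x y ≡ + (2 ℕ.* s) → sqDist n (double x) (double y) ≡ + (8 ℕ.* s)
  doubling-distance n s x y dist = begin
    sqDist n (double x) (double y)  ≡⟨ sqDist-double n x y ⟩
    + 4 * sqDist n x y              ≡⟨ cong (+ 4 *_) dist ⟩
    + 4 * + (2 ℕ.* s)               ≡⟨ four-times-2s s ⟩
    + (8 ℕ.* s)                     ∎

  halving-distance : ∀ s x y → sqDist 4 x y ≡ + (8 ℕ.* s) → sqDist 4 (halve x) (halve y) ≡ + (2 ℕ.* s)
  halving-distance s x y dist = *-cancelˡ-≡ (+ 4) _ _ (begin
    + 4 * sqDist 4 (halve x) (halve y)  ≡⟨ sqDist-halve 4 x y even ⟨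
    sqDist 4 x y                        ≡⟨ dist ⟩
    + (8 ℕ.* s)                         ≡⟨ four-times-2s s ⟨
    + 4 * + (2 ℕ.* s)                   ∎)
    where
    even : ∀ i → parity (x i) ≡ parity (y i)
    even = four-squares-mod8 x y (mod-trans (mod-reflexive dist) (multiple-mod 8 s))

  scaling-equivalence : ∀ s c → Colourable 4 (8 ℕ.* s) c ⇔ Colourable 4 (2 ℕ.* s) c
  scaling-equivalence s c = mk⇔ (pullback double (doubling-distance 4 s))
                                (pullback halve (halving-distance s))

  -- Part (3): distance √(4l) in ℤ⁴ for odd l = 2m+1.

  four-squares-even-first : ∀ x y → sqDist 4 x y ≡ + 0 mod 4 → parity (x 0F) ≡ parity (y 0F) →
                            ∀ i → parity (x i) ≡ parity (y i)
  four-squares-even-first x y s≡0 first = Sum.[ (λ even → even) , ⊥-elim ∘ not-all-odd ]′ (four-squares-mod4 x y s≡0)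
    where
    not-all-odd : (∀ i → differ (x i) (y i) ≡ true) → ⊥
    not-all-odd odd with trans (sym (odd 0F)) (differ-same {x 0F} {y 0F} first)
    ... | ()

  colour-odd : Point 4 → Fin 4
  colour-odd x = code₂ (parity (x 0F)) (parity (sumFin 4 (halve x)))

  colouring-4-odd : ∀ m → Colourable 4 (4 ℕ.* (2 ℕ.* m ℕ.+ 1)) 4
  colouring-4-odd m = colour-odd , proper
    where
    proper : ProperColouring 4 (4 ℕ.* (2 ℕ.* m ℕ.+ 1)) 4 colour-odd
    proper x y dist same = incongruent one≡zero _
      where
      equal-bits : parity (x 0F) ≡ parity (y 0F) ×
                   parity (sumFin 4 (halve x)) ≡ parity (sumFin 4 (halve y))
      equal-bits = code₂-injective same

      all-even : ∀ i → parity (x i) ≡ parity (y i)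
      all-even = four-squares-even-first x y (mod-trans (mod-reflexive dist) (multiple-mod 4 (2 ℕ.* m ℕ.+ 1)))
                                         (proj₁ equal-bits)

      halved : sqDist 4 (halve x) (halve y) ≡ + (2 ℕ.* m ℕ.+ 1)
      halved = *-cancelˡ-≡ (+ 4) _ _
                 (trans (sym (sqDist-halve 4 x y all-even)) (trans dist (pos-* 4 (2 ℕ.* m ℕ.+ 1))))

      halved-even : sqDist 4 (halve x) (halve y) ≡ + 0 mod 2
      halved-even = mod-trans (sqDist-mod2 4 (halve x) (halve y))
                              (mod-difference (same-parity-mod2 (sumFin 4 (halve x)) (sumFin 4 (halve y)) (proj₂ equal-bits)))

      one≡zero : + 1 ≡ + 0 mod 2
      one≡zero = mod-trans (mod-sym (offset-mod 2 m 1)) (mod-trans (mod-sym (mod-reflexive halved)) halved-even)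

open Colourings using (colouring-4l+2-dim4; colouring-4l+2-dim5; scaling-equivalence; colouring-4-odd)
open import Data.Nat using (_+_; _*_)

mainTheorem6 :
    ((l : ℕ) → Colourable 4 (4 * l + 2) 4 × Colourable 5 (4 * l + 2) 8)
    × ((k : ℕ) → (c : ℕ) → Colourable 4 (8 * suc k) c ⇔ Colourable 4 (2 * suc k) c)
    × ((m : ℕ) → Colourable 4 (4 * (2 * m + 1)) 4)
mainTheorem6 =
    (λ l → colouring-4l+2-dim4 l , colouring-4l+2-dim5 l)
  , (λ k → scaling-equivalence (suc k))
  , colouring-4-odd
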